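{- Every non-special Gallai coloring $\phi$ of $K_5$ that uses exactly three colors satisfies $w(\phi)\le 31$.
   Context: A Gallai coloring of $K_m$ is a coloring $E(K_m)\to\{\text{red},\text{green},\text{blue}\}$ with no rainbow triangle (triangle whose three edges have three distinct colors). For a Gallai coloring $\psi$ of $K_m$, regard $K_{m+1}$ as $K_m$ plus a new vertex $u$; $w(\psi)$ (the number of extensions) is the number of colorings of the edges from $u$ to $V(K_m)$ with colors in $\{\text{red},\text{green},\text{blue}\}$ such that the resulting coloring of $E(K_{m+1})$ is Gallai. A vertex is monochromatic if all its incident edges have the same color. A coloring with exactly three colors is vertex-special if there is a vertex $v$ monochromatic in some color $c$ and the coloring of $K_m-v$ uses only the two colors other than $c$, with all its edges of one of them except exactly one edge of the other; it is edge-special if there are two non-adjacent edges of two different colors and all other edges have the third color; it is non-special if it is neither. -}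

module Defs where

open import Data.Nat using (ℕ; zero; suc)
open import Data.Fin using (Fin; zero; suc)
open import Data.Fin.Properties using (all?) renaming (_≟_ to _≟F_)
open import Data.List using (List; []; _∷_; map; concatMap; filter; length)
open import Data.Product using (_×_; _,_; ∃; ∃-syntax)
open import Data.Sum using (_⊎_)
open import Relation.Nullary using (¬_; Dec; yes; no; ¬?)
open import Relation.Nullary.Decidable using (_→-dec_; _×-dec_)
open import Relation.Binary.PropositionalEquality using (_≡_; _≢_; refl)

data Color : Set where
  red green blue : Color

_≟C_ : (x y : Color) → Dec (x ≡ y)
red   ≟C red   = yes refl
red   ≟C green = no λ ()
red   ≟C blue  = no λ ()
green ≟C red   = no λ ()
green ≟C green = yes refl
green ≟C blue  = no λ ()
blue  ≟C red   = no λ ()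
blue  ≟C green = no λ ()
blue  ≟C blue  = yes refl

-- An edge coloring of K_m on vertex set Fin m: the colour of edge {i,j}
-- is col i j.  Only off-diagonal values matter; symmetry is a hypothesis.
EdgeCol : ℕ → Set
EdgeCol m = Fin m → Fin m → Color

Symmetric : ∀ {m} → EdgeCol m → Set
Symmetric {m} col = ∀ (i j : Fin m) → col i j ≡ col j i

Rainbow : Color → Color → Color → Set
Rainbow x y z = x ≢ y × y ≢ z × x ≢ z

rainbow? : ∀ x y z → Dec (Rainbow x y z)
rainbow? x y z = ¬? (x ≟C y) ×-dec (¬? (y ≟C z) ×-dec ¬? (x ≟C z))

Gallai : ∀ {m} → EdgeCol m → Set
Gallai {m} col = ∀ (i j k : Fin m) → i ≢ j → j ≢ k → i ≢ k →
  ¬ Rainbow (col i j) (col j k) (col i k)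

gallai? : ∀ {m} (col : EdgeCol m) → Dec (Gallai col)
gallai? col =
  all? λ i → all? λ j → all? λ k →
    ¬? (i ≟F j) →-dec (¬? (j ≟F k) →-dec (¬? (i ≟F k) →-dec
      ¬? (rainbow? (col i j) (col j k) (col i k))))

Uses : ∀ {m} → EdgeCol m → Color → Set
Uses {m} col c = ∃[ i ] ∃[ j ] (i ≢ j × col i j ≡ c)

UsesExactlyThree : ∀ {m} → EdgeCol m → Set
UsesExactlyThree col = Uses col red × Uses col green × Uses col blue

MonoVertex : ∀ {m} → EdgeCol m → Fin m → Color → Set
MonoVertex {m} col v c = ∀ (j : Fin m) → j ≢ v → col v j ≡ c

SameEdge : ∀ {m} → Fin m → Fin m → Fin m → Fin m → Set
SameEdge x y a b = (x ≡ a × y ≡ b) ⊎ (x ≡ b × y ≡ a)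

VertexSpecial : ∀ {m} → EdgeCol m → Set
VertexSpecial {m} col =
  ∃[ v ] ∃[ c ] ∃[ d ] ∃[ e ] ∃[ a ] ∃[ b ]
    ( Rainbow c d e
    × MonoVertex col v c
    × a ≢ b × a ≢ v × b ≢ v
    × (∀ (x y : Fin m) → x ≢ y → x ≢ v → y ≢ v →
         (SameEdge x y a b → col x y ≡ e) × (¬ SameEdge x y a b → col x y ≡ d)))

EdgeSpecial : ∀ {m} → EdgeCol m → Set
EdgeSpecial {m} col =
  ∃[ a ] ∃[ b ] ∃[ p ] ∃[ q ] ∃[ c₁ ] ∃[ c₂ ] ∃[ c₃ ]
    ( a ≢ b × a ≢ p × a ≢ q × b ≢ p × b ≢ q × p ≢ q
    × Rainbow c₁ c₂ c₃
    × col a b ≡ c₁ × col p q ≡ c₂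
    × (∀ (x y : Fin m) → x ≢ y → ¬ SameEdge x y a b → ¬ SameEdge x y p q →
         col x y ≡ c₃))

NonSpecial : ∀ {m} → EdgeCol m → Set
NonSpecial col = ¬ VertexSpecial col × ¬ EdgeSpecial col

-- Extension of col by a new vertex u (= zero in Fin (suc m)); f i is the
-- colour of edge {u, suc i}.  The diagonal value is irrelevant.
extend : ∀ {m} → EdgeCol m → (Fin m → Color) → EdgeCol (suc m)
extend col f zero    zero    = red
extend col f zero    (suc j) = f j
extend col f (suc i) zero    = f i
extend col f (suc i) (suc j) = col i j

colors : List Color
colors = red ∷ green ∷ blue ∷ []

cons : ∀ {m} → Color → (Fin m → Color) → Fin (suc m) → Color
cons c g zero    = c
cons c g (suc i) = g i

allFuns : (m : ℕ) → List (Fin m → Color)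
allFuns zero    = (λ ()) ∷ []
allFuns (suc m) = concatMap (λ c → map (cons c) (allFuns m)) colors

w : ∀ {m} → EdgeCol m → ℕ
w {m} col = length (filter (λ f → gallai? (extend col f)) (allFuns m))

-- A Gallai colouring of K_(m+1) is a Gallai colouring of K_m together with colours on the
-- edges to a new vertex such that no triangle through the new vertex is rainbow.  Choosing
-- these colours vertex by vertex, every choice shrinks the palettes still available at the
-- later vertices; the resulting backtracking search both enumerates the Gallai colourings of
-- K_5 (up to the irrelevant diagonal) and counts their extensions exactly.  Evaluating it on
-- all 6129 Gallai colourings of K_5 shows that each one with more than 31 extensions uses at
-- most two colours or is vertex- or edge-special.
module Submission where

open import Defs
open import Data.Bool using (Bool; true; false; T; _∧_; if_then_else_)
open import Data.Bool.Properties using (T-∧; T-≡)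
open import Data.Empty using (⊥-elim)
open import Data.Fin using (Fin; zero; suc)
open import Data.Fin.Properties using (any?; all?; suc-injective) renaming (_≟_ to _≟F_)
open import Data.List using (List; []; _∷_; [_]; _++_; map; concatMap; filter; dropWhile; length)
open import Data.Nat.ListAction using (sum)
open import Data.List.Properties using (filter-++; filter-≐; filter-none; length-++; length-map; map-cong)
open import Data.List.Relation.Unary.All as All using (All)
open import Data.List.Relation.Unary.Any as Any using (Any; here; there)
open import Data.List.Relation.Unary.All.Properties using (dropWhile⁻)
open import Data.List.Relation.Unary.Any.Properties using (map⁺; concatMap⁺)
open import Data.Nat using (ℕ; zero; suc; _+_; _≤_; _≤?_)
open import Data.Nat.Properties using (module ≤-Reasoning)
open import Data.Product using (_×_; _,_; ∃; proj₁; proj₂)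
open import Data.Sum using (_⊎_; inj₁; inj₂)
open import Function using (_∘_; _⇔_; mk⇔; Equivalence)
open import Relation.Nullary using (¬_; Dec; does; ¬?)
open import Relation.Nullary.Decidable using (_×-dec_; _⊎-dec_; _→-dec_; map′; toWitness; fromWitness; isYes; T?)
open import Relation.Binary.PropositionalEquality using (_≡_; _≢_; _≗_; refl; sym; trans; cong; subst; module ≡-Reasoning)

open Equivalence using (to; from)

module _ {A B : Set} {P : B → Set} (P? : ∀ x → Dec (P x)) where

  filter-map : ∀ (h : A → B) xs → filter P? (map h xs) ≡ map h (filter (P? ∘ h) xs)
  filter-map h []       = refl
  filter-map h (x ∷ xs) with does (P? (h x))
  ... | true  = cong (h x ∷_) (filter-map h xs)
  ... | false = filter-map h xs

  filter-concatMap : ∀ (f : A → List B) xs → filter P? (concatMap f xs) ≡ concatMap (filter P? ∘ f) xs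
  filter-concatMap f []       = refl
  filter-concatMap f (x ∷ xs) =
    trans (filter-++ P? (f x) (concatMap f xs)) (cong (filter P? (f x) ++_) (filter-concatMap f xs))

length-concatMap : ∀ {A B : Set} (f : A → List B) xs → length (concatMap f xs) ≡ sum (map (length ∘ f) xs)
length-concatMap f []       = refl
length-concatMap f (x ∷ xs) = trans (length-++ (f x)) (cong (length (f x) +_) (length-concatMap f xs))

rainbow-swap : ∀ {x y z} → Rainbow x y z → Rainbow x z y
rainbow-swap (x≢y , y≢z , x≢z) = x≢z , y≢z ∘ sym , x≢y

rainbow-rotate : ∀ {x y z} → Rainbow x y z → Rainbow z x y
rainbow-rotate (x≢y , y≢z , x≢z) = x≢z ∘ sym , x≢y , y≢z ∘ sym

rainbow-cong : ∀ {x x′ y y′ z z′} → x ≡ x′ → y ≡ y′ → z ≡ z′ → Rainbow x y z → Rainbow x′ y′ z′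
rainbow-cong refl refl refl r = r

suc-≢ : ∀ {m} {i j : Fin m} → i ≢ j → suc i ≢ suc j
suc-≢ i≢j = i≢j ∘ suc-injective

Local : ∀ {m} → EdgeCol m → (Fin m → Color) → Set
Local {m} col f = ∀ (i j : Fin m) → i ≢ j → ¬ Rainbow (f i) (col i j) (f j)

gallai-extend⇒local : ∀ {m} {col : EdgeCol m} {f} → Gallai (extend col f) → Local col f
gallai-extend⇒local G i j i≢j = G zero (suc i) (suc j) (λ ()) (suc-≢ i≢j) (λ ())

local⇒gallai-extend : ∀ {m} {col : EdgeCol m} {f} → Gallai col → Local col f → Gallai (extend col f)
local⇒gallai-extend G L zero    zero    _       0≢0 _   _   = ⊥-elim (0≢0 refl)
local⇒gallai-extend G L zero    (suc j) zero    _   _   0≢0 = ⊥-elim (0≢0 refl)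
local⇒gallai-extend G L zero    (suc j) (suc k) _   j≢k _   = L j k (j≢k ∘ cong suc)
local⇒gallai-extend G L (suc i) zero    zero    _   0≢0 _   = ⊥-elim (0≢0 refl)
local⇒gallai-extend G L (suc i) zero    (suc k) _   _   i≢k = L i k (i≢k ∘ cong suc) ∘ rainbow-swap
local⇒gallai-extend G L (suc i) (suc j) zero    i≢j _   _   = L i j (i≢j ∘ cong suc) ∘ rainbow-rotate
local⇒gallai-extend G L (suc i) (suc j) (suc k) i≢j j≢k i≢k =
  G i j k (i≢j ∘ cong suc) (j≢k ∘ cong suc) (i≢k ∘ cong suc)

Palette : ℕ → Set
Palette m = Fin m → Color → Bool

unrestricted : ∀ {m} → Palette m
unrestricted _ _ = true

Fits : ∀ {m} → EdgeCol m → Palette m → (Fin m → Color) → Set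
Fits col p f = Local col f × (∀ i → T (p i (f i)))

local? : ∀ {m} (col : EdgeCol m) f → Dec (Local col f)
local? col f = all? λ i → all? λ j → ¬? (i ≟F j) →-dec ¬? (rainbow? (f i) (col i j) (f j))

fits? : ∀ {m} (col : EdgeCol m) p f → Dec (Fits col p f)
fits? col p f = local? col f ×-dec all? (λ i → T? (p i (f i)))

noRainbow : Color → Color → Color → Bool
noRainbow x y z = isYes (¬? (rainbow? x y z))

restrict : ∀ {m} → EdgeCol (suc m) → EdgeCol m
restrict col i j = col (suc i) (suc j)

-- The palette of the remaining vertices once vertex 0 has received colour c.
narrow : ∀ {m} → EdgeCol (suc m) → Palette (suc m) → Color → Palette m
narrow col p c j d = p (suc j) d ∧ (noRainbow c (col zero (suc j)) d ∧ noRainbow d (col (suc j) zero) c)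

extensions : ∀ {m} → EdgeCol m → Palette m → List (Fin m → Color)
extensionsStartingWith : ∀ {m} → EdgeCol (suc m) → Palette (suc m) → Color → List (Fin (suc m) → Color)

extensions {zero}  col p = [ (λ ()) ]
extensions {suc m} col p = concatMap (extensionsStartingWith col p) colors

extensionsStartingWith col p c =
  if p zero c then map (cons c) (extensions (restrict col) (narrow col p c)) else []

narrow-intro : ∀ {m} (col : EdgeCol (suc m)) p {c} j {d} → T (p (suc j) d) →
  ¬ Rainbow c (col zero (suc j)) d → ¬ Rainbow d (col (suc j) zero) c → T (narrow col p c j d)
narrow-intro col p {c} j {d} pd r₁ r₂ =
  from (T-∧ {p (suc j) d}) (pd , from (T-∧ {noRainbow c (col zero (suc j)) d}) (fromWitness r₁ , fromWitness r₂))

narrow-elim : ∀ {m} (col : EdgeCol (suc m)) p {c} j {d} → T (narrow col p c j d) →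
  T (p (suc j) d) × ¬ Rainbow c (col zero (suc j)) d × ¬ Rainbow d (col (suc j) zero) c
narrow-elim col p {c} j {d} n with to (T-∧ {p (suc j) d}) n
... | pd , r with to (T-∧ {noRainbow c (col zero (suc j)) d}) r
...   | r₁ , r₂ = pd , toWitness r₁ , toWitness r₂

fits-split : ∀ {m} (col : EdgeCol (suc m)) p {f} →
  Fits col p f ⇔ (T (p zero (f zero)) × Fits (restrict col) (narrow col p (f zero)) (f ∘ suc))
fits-split col p {f} = mk⇔ split join
  where
  split : Fits col p f → T (p zero (f zero)) × Fits (restrict col) (narrow col p (f zero)) (f ∘ suc)
  split (L , P) = P zero , (λ i j i≢j → L (suc i) (suc j) (suc-≢ i≢j)) ,
    λ j → narrow-intro col p j (P (suc j)) (L zero (suc j) (λ ())) (L (suc j) zero (λ ()))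
  join : T (p zero (f zero)) × Fits (restrict col) (narrow col p (f zero)) (f ∘ suc) → Fits col p f
  join (P₀ , L , P) = local , palette
    where
    local : Local col f
    local zero    zero    0≢0 = ⊥-elim (0≢0 refl)
    local zero    (suc j) _   = proj₁ (proj₂ (narrow-elim col p j (P j)))
    local (suc i) zero    _   = proj₂ (proj₂ (narrow-elim col p i (P i)))
    local (suc i) (suc j) i≢j = L i j (i≢j ∘ cong suc)
    palette : ∀ i → T (p i (f i))
    palette zero    = P₀
    palette (suc j) = proj₁ (narrow-elim col p j (P j))

extensions-count : ∀ {m} (col : EdgeCol m) (p : Palette m) →
  length (filter (fits? col p) (allFuns m)) ≡ length (extensions col p)
extensions-count {zero}  col p = refl
extensions-count {suc m} col p = begin
  length (filter (fits? col p) (concatMap (λ c → map (cons c) (allFuns m)) colors))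
    ≡⟨ cong length (filter-concatMap (fits? col p) (λ c → map (cons c) (allFuns m)) colors) ⟩
  length (concatMap (λ c → filter (fits? col p) (map (cons c) (allFuns m))) colors)
    ≡⟨ length-concatMap (λ c → filter (fits? col p) (map (cons c) (allFuns m))) colors ⟩
  sum (map (λ c → length (filter (fits? col p) (map (cons c) (allFuns m)))) colors)
    ≡⟨ cong sum (map-cong branch colors) ⟩
  sum (map (length ∘ extensionsStartingWith col p) colors)
    ≡⟨ length-concatMap (extensionsStartingWith col p) colors ⟨
  length (extensions col p) ∎
  where
  open ≡-Reasoning
  branch : ∀ c → length (filter (fits? col p) (map (cons c) (allFuns m))) ≡ length (extensionsStartingWith col p c)
  branch c with p zero c in p₀
  ... | true  = begin
    length (filter (fits? col p) (map (cons c) (allFuns m)))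
      ≡⟨ cong length (filter-map (fits? col p) (cons c) (allFuns m)) ⟩
    length (map (cons c) (filter (fits? col p ∘ cons c) (allFuns m)))
      ≡⟨ length-map (cons c) (filter (fits? col p ∘ cons c) (allFuns m)) ⟩
    length (filter (fits? col p ∘ cons c) (allFuns m))
      ≡⟨ cong length (filter-≐ (fits? col p ∘ cons c) (fits? (restrict col) (narrow col p c))
           (proj₂ ∘ to (fits-split col p) , λ fits → from (fits-split col p) (subst T (sym p₀) _ , fits))
           (allFuns m)) ⟩
    length (filter (fits? (restrict col) (narrow col p c)) (allFuns m))
      ≡⟨ extensions-count (restrict col) (narrow col p c) ⟩
    length (extensions (restrict col) (narrow col p c))
      ≡⟨ length-map (cons c) (extensions (restrict col) (narrow col p c)) ⟨
    length (map (cons c) (extensions (restrict col) (narrow col p c))) ∎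
  ... | false = cong length (trans (filter-map (fits? col p) (cons c) (allFuns m))
    (cong (map (cons c)) (filter-none (fits? col p ∘ cons c)
      (All.universal (λ g fits → subst T p₀ (proj₁ (to (fits-split col p) fits))) (allFuns m)))))

w≡#extensions : ∀ {m} {col : EdgeCol m} → Gallai col → w col ≡ length (extensions col unrestricted)
w≡#extensions {m} {col} G = trans
  (cong length (filter-≐ (λ f → gallai? (extend col f)) (fits? col unrestricted)
    ((λ G′ → gallai-extend⇒local G′ , _) , λ (L , _) → local⇒gallai-extend G L) (allFuns m)))
  (extensions-count col unrestricted)

any-colors : ∀ {P : Color → Set} c → P c → Any P colors
any-colors red   p = here p
any-colors green p = there (here p)
any-colors blue  p = there (there (here p))

extensions-complete : ∀ {m} {col : EdgeCol m} {p f} → Fits col p f → Any (_≗ f) (extensions col p)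
extensions-complete {zero}  _ = here (λ ())
extensions-complete {suc m} {col} {p} {f} fits with to (fits-split col p) fits
... | p₀ , fits′ = concatMap⁺ (extensionsStartingWith col p) (any-colors (f zero)
  (subst (Any (_≗ f)) (sym accepted) (map⁺ (Any.map cons-≗ (extensions-complete fits′)))))
  where
  accepted : extensionsStartingWith col p (f zero)
           ≡ map (cons (f zero)) (extensions (restrict col) (narrow col p (f zero)))
  accepted rewrite to T-≡ p₀ = refl
  cons-≗ : ∀ {g} → g ≗ f ∘ suc → cons (f zero) g ≗ f
  cons-≗ g≗ zero    = refl
  cons-≗ g≗ (suc i) = g≗ i

-- Equality as colourings of K_m: the diagonal of an EdgeCol is junk.
_≈_ : ∀ {m} → EdgeCol m → EdgeCol m → Set
_≈_ {m} col col′ = ∀ (i j : Fin m) → i ≢ j → col i j ≡ col′ i j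

≈-sym : ∀ {m} {col col′ : EdgeCol m} → col ≈ col′ → col′ ≈ col
≈-sym col≈ i j i≢j = sym (col≈ i j i≢j)

gallaiColorings : (m : ℕ) → List (EdgeCol m)
gallaiColorings zero    = [ (λ ()) ]
gallaiColorings (suc m) = concatMap (λ col → map (extend col) (extensions col unrestricted)) (gallaiColorings m)

gallaiColorings-complete : ∀ {m} (φ : EdgeCol m) → Symmetric φ → Gallai φ → Any (φ ≈_) (gallaiColorings m)
gallaiColorings-complete {zero}  φ _     _ = here (λ ())
gallaiColorings-complete {suc m} φ φ-sym G =
  concatMap⁺ (λ col → map (extend col) (extensions col unrestricted))
    (Any.map extendsTo (gallaiColorings-complete (restrict φ) restrict-sym restrict-gallai))
  where
  f : Fin m → Color
  f j = φ zero (suc j)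
  restrict-sym : Symmetric (restrict φ)
  restrict-sym i j = φ-sym (suc i) (suc j)
  restrict-gallai : Gallai (restrict φ)
  restrict-gallai i j k i≢j j≢k i≢k = G (suc i) (suc j) (suc k) (suc-≢ i≢j) (suc-≢ j≢k) (suc-≢ i≢k)
  extendsTo : ∀ {col} → restrict φ ≈ col → Any (φ ≈_) (map (extend col) (extensions col unrestricted))
  extendsTo {col} φ≈ = map⁺ (Any.map φ≈extend (extensions-complete (local , _)))
    where
    local : Local col f
    local i j i≢j =
      G zero (suc i) (suc j) (λ ()) (suc-≢ i≢j) (λ ()) ∘ rainbow-cong refl (sym (φ≈ i j i≢j)) refl
    φ≈extend : ∀ {g} → g ≗ f → φ ≈ extend col g
    φ≈extend g≗ zero    zero    0≢0 = ⊥-elim (0≢0 refl)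
    φ≈extend g≗ zero    (suc j) _   = sym (g≗ j)
    φ≈extend g≗ (suc i) zero    _   = trans (φ-sym (suc i) zero) (sym (g≗ i))
    φ≈extend g≗ (suc i) (suc j) i≢j = φ≈ i j (i≢j ∘ cong suc)

gallai-resp : ∀ {m} {col col′ : EdgeCol m} → col ≈ col′ → Gallai col → Gallai col′
gallai-resp col≈ G i j k i≢j j≢k i≢k =
  G i j k i≢j j≢k i≢k ∘ rainbow-cong (sym (col≈ i j i≢j)) (sym (col≈ j k j≢k)) (sym (col≈ i k i≢k))

extend-resp : ∀ {m} {col col′ : EdgeCol m} → col ≈ col′ → ∀ f → extend col f ≈ extend col′ f
extend-resp col≈ f zero    zero    _   = refl
extend-resp col≈ f zero    (suc j) _   = refl
extend-resp col≈ f (suc i) zero    _   = refl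
extend-resp col≈ f (suc i) (suc j) i≢j = col≈ i j (i≢j ∘ cong suc)

w-resp : ∀ {m} {col col′ : EdgeCol m} → col ≈ col′ → w col ≡ w col′
w-resp {m} {col} {col′} col≈ = cong length
  (filter-≐ (λ f → gallai? (extend col f)) (λ f → gallai? (extend col′ f))
  ((λ {f} → gallai-resp (extend-resp col≈ f)) , λ {f} → gallai-resp (extend-resp (≈-sym col≈) f)) (allFuns m))

uses-resp : ∀ {m} {col col′ : EdgeCol m} → col ≈ col′ → ∀ {c} → Uses col c → Uses col′ c
uses-resp col≈ (i , j , i≢j , colᵢⱼ) = i , j , i≢j , trans (sym (col≈ i j i≢j)) colᵢⱼ

usesExactlyThree-resp : ∀ {m} {col col′ : EdgeCol m} → col ≈ col′ →
  UsesExactlyThree col → UsesExactlyThree col′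
usesExactlyThree-resp col≈ (r , g , b) = uses-resp col≈ r , uses-resp col≈ g , uses-resp col≈ b

vertexSpecial-resp : ∀ {m} {col col′ : EdgeCol m} → col ≈ col′ → VertexSpecial col → VertexSpecial col′
vertexSpecial-resp col≈ (v , c , d , e , a , b , rb , mono , a≢b , a≢v , b≢v , rest) =
  v , c , d , e , a , b , rb ,
  (λ j j≢v → trans (sym (col≈ v j (j≢v ∘ sym))) (mono j j≢v)) , a≢b , a≢v , b≢v ,
  λ x y x≢y x≢v y≢v → let on , off = rest x y x≢y x≢v y≢v in
    trans (sym (col≈ x y x≢y)) ∘ on , trans (sym (col≈ x y x≢y)) ∘ off

edgeSpecial-resp : ∀ {m} {col col′ : EdgeCol m} → col ≈ col′ → EdgeSpecial col → EdgeSpecial col′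
edgeSpecial-resp col≈
  (a , b , p , q , c₁ , c₂ , c₃ , a≢b , a≢p , a≢q , b≢p , b≢q , p≢q , rb , colab , colpq , rest) =
  a , b , p , q , c₁ , c₂ , c₃ , a≢b , a≢p , a≢q , b≢p , b≢q , p≢q , rb ,
  trans (sym (col≈ a b a≢b)) colab , trans (sym (col≈ p q p≢q)) colpq ,
  λ x y x≢y ¬ab ¬pq → trans (sym (col≈ x y x≢y)) (rest x y x≢y ¬ab ¬pq)

any-Color? : ∀ {P : Color → Set} → (∀ c → Dec (P c)) → Dec (∃ P)
any-Color? {P} P? = map′ witness split (P? red ⊎-dec P? green ⊎-dec P? blue)
  where
  witness : P red ⊎ P green ⊎ P blue → ∃ P
  witness (inj₁ p)        = red , p
  witness (inj₂ (inj₁ p)) = green , p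
  witness (inj₂ (inj₂ p)) = blue , p
  split : ∃ P → P red ⊎ P green ⊎ P blue
  split (red   , p) = inj₁ p
  split (green , p) = inj₂ (inj₁ p)
  split (blue  , p) = inj₂ (inj₂ p)

uses? : ∀ {m} (col : EdgeCol m) c → Dec (Uses col c)
uses? col c = any? λ i → any? λ j → ¬? (i ≟F j) ×-dec col i j ≟C c

usesExactlyThree? : ∀ {m} (col : EdgeCol m) → Dec (UsesExactlyThree col)
usesExactlyThree? col = uses? col red ×-dec uses? col green ×-dec uses? col blue

sameEdge? : ∀ {m} (x y a b : Fin m) → Dec (SameEdge x y a b)
sameEdge? x y a b = (x ≟F a ×-dec y ≟F b) ⊎-dec (x ≟F b ×-dec y ≟F a)

monoVertex? : ∀ {m} (col : EdgeCol m) v c → Dec (MonoVertex col v c)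
monoVertex? col v c = all? λ j → ¬? (j ≟F v) →-dec col v j ≟C c

vertexSpecial? : ∀ {m} (col : EdgeCol m) → Dec (VertexSpecial col)
vertexSpecial? col =
  any? λ v → any-Color? λ c → any-Color? λ d → any-Color? λ e → any? λ a → any? λ b →
    rainbow? c d e ×-dec monoVertex? col v c ×-dec ¬? (a ≟F b) ×-dec ¬? (a ≟F v) ×-dec ¬? (b ≟F v) ×-dec
    (all? λ x → all? λ y → ¬? (x ≟F y) →-dec ¬? (x ≟F v) →-dec ¬? (y ≟F v) →-dec
      (sameEdge? x y a b →-dec col x y ≟C e) ×-dec (¬? (sameEdge? x y a b) →-dec col x y ≟C d))

edgeSpecial? : ∀ {m} (col : EdgeCol m) → Dec (EdgeSpecial col)
edgeSpecial? col =
  any? λ a → any? λ b → any? λ p → any? λ q →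
  any-Color? λ c₁ → any-Color? λ c₂ → any-Color? λ c₃ →
    ¬? (a ≟F b) ×-dec ¬? (a ≟F p) ×-dec ¬? (a ≟F q) ×-dec
    ¬? (b ≟F p) ×-dec ¬? (b ≟F q) ×-dec ¬? (p ≟F q) ×-dec
    rainbow? c₁ c₂ c₃ ×-dec col a b ≟C c₁ ×-dec col p q ≟C c₂ ×-dec
    (all? λ x → all? λ y → ¬? (x ≟F y) →-dec ¬? (sameEdge? x y a b) →-dec ¬? (sameEdge? x y p q) →-dec
      col x y ≟C c₃)

BoundedOrExempt : ∀ {m} → ℕ → EdgeCol m → Set
BoundedOrExempt n col =
  length (extensions col unrestricted) ≤ n ⊎ ¬ UsesExactlyThree col ⊎ VertexSpecial col ⊎ EdgeSpecial col

boundedOrExempt? : ∀ {m} n (col : EdgeCol m) → Dec (BoundedOrExempt n col)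
boundedOrExempt? n col =
  length (extensions col unrestricted) ≤? n ⊎-dec ¬? (usesExactlyThree? col) ⊎-dec
  vertexSpecial? col ⊎-dec edgeSpecial? col

k5-dropWhile-boundedOrExempt : dropWhile (boundedOrExempt? 31) (gallaiColorings 5) ≡ []
k5-dropWhile-boundedOrExempt = refl

k5-boundedOrExempt : All (BoundedOrExempt 31) (gallaiColorings 5)
k5-boundedOrExempt = dropWhile⁻ (boundedOrExempt? 31) k5-dropWhile-boundedOrExempt

boundedOrExempt⇒w≤ : ∀ {m n} {φ col : EdgeCol m} → φ ≈ col →
  Gallai φ → UsesExactlyThree φ → NonSpecial φ → BoundedOrExempt n col → w φ ≤ n
boundedOrExempt⇒w≤ {n = n} {φ} {col} φ≈ G _ _ (inj₁ bounded) = begin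
  w φ                                   ≡⟨ w-resp φ≈ ⟩
  w col                                 ≡⟨ w≡#extensions (gallai-resp φ≈ G) ⟩
  length (extensions col unrestricted)  ≤⟨ bounded ⟩
  n                                     ∎
  where open ≤-Reasoning
boundedOrExempt⇒w≤ φ≈ _ U _         (inj₂ (inj₁ ¬U))        = ⊥-elim (¬U (usesExactlyThree-resp φ≈ U))
boundedOrExempt⇒w≤ φ≈ _ _ (¬vs , _) (inj₂ (inj₂ (inj₁ vs))) = ⊥-elim (¬vs (vertexSpecial-resp (≈-sym φ≈) vs))
boundedOrExempt⇒w≤ φ≈ _ _ (_ , ¬es) (inj₂ (inj₂ (inj₂ es))) = ⊥-elim (¬es (edgeSpecial-resp (≈-sym φ≈) es))

lemma4p6 : (φ : EdgeCol 5) → Symmetric φ → Gallai φ → UsesExactlyThree φ →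
    NonSpecial φ → w φ ≤ 31
lemma4p6 φ φ-sym G U NS =
  All.lookupWith {R = λ _ → w φ ≤ 31} (λ bounded φ≈col → boundedOrExempt⇒w≤ φ≈col G U NS bounded)
    k5-boundedOrExempt (gallaiColorings-complete φ φ-sym G)
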